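{- If $G$ is a graph with $\delta(G)\ge 2$, then $$\mathrm{TC}_2(G)\le \max\Big\{\Delta(G),\ \Big\lfloor\frac{\delta(G)}{2}\Big\rfloor(\Delta(G)-4)+\delta(G)\Big\}.$$ Moreover, this bound is sharp: there exist graphs $G$ with $\delta(G)\ge 2$ for which equality holds.
   Context: All graphs are finite, simple and connected; $\delta(G)$ and $\Delta(G)$ denote minimum and maximum degree. For a vertex $v$, $N(v)$ denotes its open neighborhood. A set $S\subseteq V(G)$ is a total $2$-dominating set if $|N(v)\cap S|\ge 2$ for every $v\in V(G)$. Two disjoint sets $U,W\subseteq V(G)$ form a total $2$-coalition if neither is a total $2$-dominating set but $U\cup W$ is. A total $2$-coalition partition of $G$ is a partition $\Omega$ of $V(G)$ such that every set of $\Omega$ forms a total $2$-coalition with some other set of $\Omega$. $\mathrm{TC}_2(G)$ is the maximum cardinality of a total $2$-coalition partition of $G$. -}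

module Defs where

open import Data.Nat using (ℕ; zero; suc; _+_; _*_; _∸_; _≤_; _⊔_; _⊓_; _/_)
open import Data.Bool using (Bool; true; false; if_then_else_; _∨_; _∧_)
open import Data.Fin using (Fin; _≟_)
open import Data.Nat.ListAction using (sum)
open import Data.List using (List; tabulate; map; foldr; allFin)
open import Data.Product using (Σ; ∃; ∃-syntax; _×_; _,_)
open import Relation.Binary.PropositionalEquality using (_≡_; _≢_)
open import Relation.Nullary using (¬_)
open import Relation.Nullary.Decidable using (⌊_⌋)

record Graph : Set where
  field
    m     : ℕ
    adj   : Fin (suc m) → Fin (suc m) → Bool
    sym   : ∀ u v → adj u v ≡ adj v u
    irrfl : ∀ v → adj v v ≡ false

  V : Set
  V = Fin (suc m)

  data Reach (u : V) : V → Set where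
    here : Reach u u
    step : ∀ {v w} → Reach u v → adj v w ≡ true → Reach u w

open Graph public

Connected : Graph → Set
Connected G = ∀ (u v : V G) → Reach G u v

countV : (G : Graph) → (V G → Bool) → ℕ
countV G P = sum (tabulate (λ u → if P u then 1 else 0))

nbrsIn : (G : Graph) → V G → (V G → Bool) → ℕ
nbrsIn G v S = countV G (λ u → adj G v u ∧ S u)

deg : (G : Graph) → V G → ℕ
deg G v = nbrsIn G v (λ _ → true)

maxDeg : Graph → ℕ
maxDeg G = foldr _⊔_ 0 (map (deg G) (allFin (suc (m G))))

minDeg : Graph → ℕ
minDeg G = foldr _⊓_ (deg G Data.Fin.zero) (map (deg G) (allFin (suc (m G))))

IsTotal2Dom : (G : Graph) → (V G → Bool) → Set
IsTotal2Dom G S = ∀ v → 2 ≤ nbrsIn G v S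

-- A partition of V(G) into k (nonempty) classes, given by a surjective
-- class-assignment c : V → Fin k; class i is {v | c v = i}.
record Partition (G : Graph) (k : ℕ) : Set where
  field
    cls  : V G → Fin k
    onto : ∀ (i : Fin k) → ∃[ v ] cls v ≡ i

open Partition public

classOf : {G : Graph} {k : ℕ} → Partition G k → Fin k → V G → Bool
classOf P i v = ⌊ cls P v ≟ i ⌋

unionOf : {G : Graph} {k : ℕ} → Partition G k → Fin k → Fin k → V G → Bool
unionOf P i j v = classOf P i v ∨ classOf P j v

-- classes i and j (disjoint since distinct) form a total 2-coalition
Total2Coalition : {G : Graph} {k : ℕ} → Partition G k → Fin k → Fin k → Set
Total2Coalition {G} P i j =
  ¬ IsTotal2Dom G (classOf P i) × ¬ IsTotal2Dom G (classOf P j)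
  × IsTotal2Dom G (unionOf P i j)

IsTC2Partition : {G : Graph} {k : ℕ} → Partition G k → Set
IsTC2Partition {G} {k} P =
  ∀ (i : Fin k) → ∃[ j ] (j ≢ i × Total2Coalition P i j)

HasTC2 : Graph → ℕ → Set
HasTC2 G t =
  (Σ (Partition G t) IsTC2Partition)
  × (∀ (k : ℕ) (P : Partition G k) → IsTC2Partition P → k ≤ t)

-- the bound max{Δ, ⌊δ/2⌋(Δ-4)+δ}; truncated subtraction is harmless here
-- since when Δ < 4 the second term is ≤ δ ≤ Δ under either convention.
bound : Graph → ℕ
bound G = maxDeg G ⊔ ((minDeg G / 2) * (maxDeg G ∸ 4) + minDeg G)

-- Let x be a vertex of minimum degree and, for a total 2-coalition partition
-- V₁, …, V_k, let w v i = |N(v) ∩ Vᵢ|.  Every class i has a partner π i with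
-- w v i + w v (π i) ≥ 2 for all v, and a vertex yᵢ with w yᵢ i ≤ 1.  A class
-- missed by x (w x i = 0) has a partner that is heavy for x (w x ≥ 2); if h
-- classes are hit by x and t of them are heavy, then h + t ≤ δ and 2t ≤ δ.
-- If every heavy class is the partner of at most Δ − 3 missed classes, then
-- k ≤ h + t(Δ − 3) ≤ δ + ⌊δ/2⌋(Δ − 4).  Otherwise some class j is the partner
-- of p ≥ Δ − 2 missed classes, and y_j has a neighbour in each of them, which
-- leaves it at most two further neighbours.  This forces every missed class to
-- be partnered with j; then either there is a second heavy class, and
-- p ≤ 2(Δ − 3), or h ≤ Δ − p, and k = h + p ≤ Δ.

module Submission where

open import Defs
open import Data.Nat using (ℕ; _≤_)
open import Data.Product using (Σ; ∃; ∃-syntax; _×_)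

open import Data.Bool using (Bool; true; false; if_then_else_; _∧_; _∨_; not)
open import Data.Bool.Properties using (∧-identityʳ)
open import Data.Fin using (Fin; zero; suc; punchOut)
open import Data.Fin.Properties using (_≟_; any?; ¬∀⟶∃¬; punchIn-punchOut; punchOut-injective)
open import Data.List using (List; []; _∷_; foldr; map; allFin; tabulate)
open import Data.List.Membership.Propositional using (_∈_)
open import Data.List.Membership.Propositional.Properties using (∈-map⁺; ∈-allFin)
open import Data.List.Relation.Unary.Any using (here; there)
open import Data.Nat using (zero; suc; _+_; _*_; _∸_; _⊔_; _⊓_; _/_; _<_; z≤n; s≤s; _≤?_; _<?_)
open import Data.Nat.DivMod using (m*n/n≡m; /-monoˡ-≤)
open import Data.Nat.Properties
  using ( +-*-semiring; +-assoc; +-comm; +-identityʳ; *-comm; *-suc; *-identityˡ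
        ; ≤-refl; ≤-reflexive; ≤-trans; ≤-pred; <⇒≤; <⇒≱; ≰⇒>; ≮⇒≥; n<1⇒n≡0; n≤0⇒n≡0
        ; +-mono-≤; +-monoʳ-≤; +-monoˡ-≤; *-monoˡ-≤; *-monoʳ-≤; +-cancelʳ-≤
        ; +-suc; m≤m+n; m≤n+m; m≤n+m∸n; m+[n∸m]≡n; m+n≤o⇒m≤o∸n
        ; m≤m⊔n; m≤n⇒m≤o⊔n; m≤n⇒m≤n⊔o; ⊓-sel
        ; module ≤-Reasoning )
open import Data.Nat.ListAction using (sum)
open import Data.Product using (_,_; proj₁; proj₂)
open import Data.Sum using (_⊎_; inj₁; inj₂)
open import Data.Vec.Functional using (removeAt)
open import Function using (_∘_)
open import Relation.Binary.PropositionalEquality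
  using (_≡_; _≢_; refl; trans; cong; cong₂; subst; ≡-≟-identity; ≢-≟-identity; module ≡-Reasoning)
import Relation.Binary.PropositionalEquality as ≡
open import Relation.Nullary using (¬_; yes; no; contradiction)
open import Relation.Nullary.Decidable using (⌊_⌋; _×-dec_; ¬?)

open import Algebra.Properties.Semiring.Sum +-*-semiring
  using (∑-distrib-+; ∑-comm; sum-cong-≗; sum-remove; sum-replicate-zero; *-distribˡ-sum; *-distribʳ-sum)
  renaming (sum to ∑)

-- Sums over Fin n

∑-tabulate : ∀ {n} (f : Fin n → ℕ) → sum (tabulate f) ≡ ∑ f
∑-tabulate {zero}  f = refl
∑-tabulate {suc n} f = cong (f zero +_) (∑-tabulate (f ∘ suc))

∑-const-1 : ∀ n → ∑ {n} (λ _ → 1) ≡ n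
∑-const-1 zero    = refl
∑-const-1 (suc n) = cong suc (∑-const-1 n)

∑-mono-≤ : ∀ {n} {f g : Fin n → ℕ} → (∀ i → f i ≤ g i) → ∑ f ≤ ∑ g
∑-mono-≤ {zero}  f≤g = z≤n
∑-mono-≤ {suc n} f≤g = +-mono-≤ (f≤g zero) (∑-mono-≤ (f≤g ∘ suc))

∑-positive : ∀ {n} (f : Fin n → ℕ) → 1 ≤ ∑ f → ∃[ i ] 1 ≤ f i
∑-positive {suc n} f 1≤∑ with 1 ≤? f zero
... | yes 1≤f₀ = zero , 1≤f₀
... | no  1≰f₀ with ∑-positive (f ∘ suc) (subst (λ a → 1 ≤ a + ∑ (f ∘ suc)) (n<1⇒n≡0 (≰⇒> 1≰f₀)) 1≤∑)
...   | i , 1≤fᵢ = suc i , 1≤fᵢ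

∑-point : ∀ {n} (f : Fin n → ℕ) i → f i ≤ ∑ f
∑-point f zero    = m≤m+n (f zero) _
∑-point f (suc i) = ≤-trans (∑-point (f ∘ suc) i) (m≤n+m _ (f zero))

∑-pair : ∀ {n} (f : Fin n → ℕ) {i j} → i ≢ j → f i + f j ≤ ∑ f
∑-pair {suc n} f {i} {j} i≢j = begin
  f i + f j                          ≡⟨ cong (λ l → f i + f l) (punchIn-punchOut i≢j) ⟨
  f i + removeAt f i (punchOut i≢j)  ≤⟨ +-monoʳ-≤ (f i) (∑-point (removeAt f i) _) ⟩
  f i + ∑ (removeAt f i)             ≡⟨ sum-remove f ⟨
  ∑ f                                ∎
  where open ≤-Reasoning

∑-triple : ∀ {n} (f : Fin n → ℕ) {i j l} → i ≢ j → i ≢ l → j ≢ l → f i + f j + f l ≤ ∑ f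
∑-triple {suc n} f {i} {j} {l} i≢j i≢l j≢l = begin
  f i + f j + f l                  ≡⟨ +-assoc (f i) (f j) (f l) ⟩
  f i + (f j + f l)                ≡⟨ cong₂ (λ a b → f i + (f a + f b)) (punchIn-punchOut i≢j) (punchIn-punchOut i≢l) ⟨
  f i + (f′ (punchOut i≢j) + f′ (punchOut i≢l))
    ≤⟨ +-monoʳ-≤ (f i) (∑-pair f′ (j≢l ∘ punchOut-injective i≢j i≢l)) ⟩
  f i + ∑ f′                       ≡⟨ sum-remove f ⟨
  ∑ f                              ∎
  where
  open ≤-Reasoning
  f′ : Fin _ → ℕ
  f′ = removeAt f i

pointMass : ∀ {n} → Fin n → ℕ → Fin n → ℕ
pointMass a x b = if ⌊ a ≟ b ⌋ then x else 0

pointMass-diag : ∀ {n} (a : Fin n) x → pointMass a x a ≡ x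
pointMass-diag a x = cong (λ d → if ⌊ d ⌋ then x else 0) (≡-≟-identity _≟_ refl)

pointMass-≢ : ∀ {n} {a b : Fin n} x → a ≢ b → pointMass a x b ≡ 0
pointMass-≢ x a≢b = cong (λ d → if ⌊ d ⌋ then x else 0) (≢-≟-identity _≟_ a≢b)

pointMass-suc : ∀ {n} (a b : Fin n) x → pointMass (suc a) x (suc b) ≡ pointMass a x b
pointMass-suc a b x with a ≟ b
... | yes _ = refl
... | no  _ = refl

pointMass≤ : ∀ {n} {f : Fin n → ℕ} {a x} → x ≤ f a → ∀ b → pointMass a x b ≤ f b
pointMass≤ {a = a} x≤fa b with a ≟ b
... | yes refl = x≤fa
... | no  _    = z≤n

pointMass-pos : ∀ {n} {a b : Fin n} {x} → 1 ≤ pointMass a x b → a ≡ b × 1 ≤ x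
pointMass-pos {a = a} {b} {x} 1≤ with a ≟ b
... | yes a≡b = a≡b , 1≤
... | no  _   = contradiction 1≤ λ ()

∑-pointMass : ∀ {n} (a : Fin n) x → ∑ (pointMass a x) ≡ x
∑-pointMass {suc n} zero    x = trans (cong (x +_) (sum-replicate-zero n)) (+-identityʳ x)
∑-pointMass {suc n} (suc a) x = trans (sum-cong-≗ (λ b → pointMass-suc a b x)) (∑-pointMass a x)

∑-fibres : ∀ {m n} (g : Fin m → Fin n) (f : Fin m → ℕ) →
           ∑ (λ j → ∑ (λ u → pointMass (g u) (f u) j)) ≡ ∑ f
∑-fibres g f =
  trans (∑-comm (λ j u → pointMass (g u) (f u) j)) (sum-cong-≗ (λ u → ∑-pointMass (g u) (f u)))

-- Counting classes against a vertex of minimum degree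

𝟙[≡0] 𝟙[≥1] 𝟙[≥2] : ℕ → ℕ
𝟙[≡0] zero    = 1
𝟙[≡0] (suc _) = 0
𝟙[≥1] zero    = 0
𝟙[≥1] (suc _) = 1
𝟙[≥2] (suc (suc _)) = 1
𝟙[≥2] _             = 0

𝟙[≥1]+𝟙[≡0]≡1 : ∀ n → 𝟙[≥1] n + 𝟙[≡0] n ≡ 1
𝟙[≥1]+𝟙[≡0]≡1 zero    = refl
𝟙[≥1]+𝟙[≡0]≡1 (suc _) = refl

𝟙[≥1]+𝟙[≥2]≤n : ∀ n → 𝟙[≥1] n + 𝟙[≥2] n ≤ n
𝟙[≥1]+𝟙[≥2]≤n zero          = z≤n
𝟙[≥1]+𝟙[≥2]≤n (suc zero)    = ≤-refl
𝟙[≥1]+𝟙[≥2]≤n (suc (suc _)) = s≤s (s≤s z≤n)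

2*𝟙[≥2]≤n : ∀ n → 2 * 𝟙[≥2] n ≤ n
2*𝟙[≥2]≤n (suc (suc _)) = s≤s (s≤s z≤n)
2*𝟙[≥2]≤n zero          = z≤n
2*𝟙[≥2]≤n (suc zero)    = z≤n

𝟙[≥2]-≥2 : ∀ {n} → 2 ≤ n → 𝟙[≥2] n ≡ 1
𝟙[≥2]-≥2 (s≤s (s≤s _)) = refl

𝟙[≥1]-≥1 : ∀ {n} → 1 ≤ n → 𝟙[≥1] n ≡ 1
𝟙[≥1]-≥1 (s≤s _) = refl

𝟙[≥1]≤ : ∀ {n m} → (1 ≤ n → 1 ≤ m) → 𝟙[≥1] n ≤ m
𝟙[≥1]≤ {zero}  _       = z≤n
𝟙[≥1]≤ {suc _} 1≤n⇒1≤m = 1≤n⇒1≤m (s≤s z≤n)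

𝟙[≡0]≤1 : ∀ n → 𝟙[≡0] n ≤ 1
𝟙[≡0]≤1 zero    = ≤-refl
𝟙[≡0]≤1 (suc _) = z≤n

𝟙[≡0]-pos : ∀ {n} → 1 ≤ 𝟙[≡0] n → n ≡ 0
𝟙[≡0]-pos {zero} _ = refl

𝟙[≡0]-≥1 : ∀ {n} → 1 ≤ n → 𝟙[≡0] n ≡ 0
𝟙[≡0]-≥1 (s≤s _) = refl

2≤m+n⇒n≤1⇒1≤m : ∀ {m n} → 2 ≤ m + n → n ≤ 1 → 1 ≤ m
2≤m+n⇒n≤1⇒1≤m {zero}  2≤n n≤1 = contradiction (≤-trans 2≤n n≤1) λ { (s≤s ()) }
2≤m+n⇒n≤1⇒1≤m {suc _} _   _   = s≤s z≤n

m∸n≤1+m∸[1+n] : ∀ m n → m ∸ n ≤ suc (m ∸ suc n)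
m∸n≤1+m∸[1+n] zero    zero    = z≤n
m∸n≤1+m∸[1+n] zero    (suc n) = z≤n
m∸n≤1+m∸[1+n] (suc m) zero    = ≤-refl
m∸n≤1+m∸[1+n] (suc m) (suc n) = m∸n≤1+m∸[1+n] m n

Δ∸2≤2*[Δ∸3] : ∀ {Δ} → 4 ≤ Δ → Δ ∸ 2 ≤ 2 * (Δ ∸ 3)
Δ∸2≤2*[Δ∸3] {suc (suc (suc (suc d)))} (s≤s (s≤s (s≤s (s≤s _)))) =
  ≤-trans (+-monoʳ-≤ 2 (m≤m+n d (d + 0))) (≤-reflexive (≡.sym (*-suc 2 d)))

count≤bound : ∀ {h z t δ Δ} → h + t ≤ δ → 2 * t ≤ δ → z ≤ t * (Δ ∸ 3) →
              h + z ≤ Δ ⊔ (δ / 2 * (Δ ∸ 4) + δ)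
count≤bound {h} {z} {t} {δ} {Δ} h+t≤δ 2t≤δ z≤t[Δ∸3] = m≤n⇒m≤o⊔n Δ (begin
  h + z                  ≤⟨ +-monoʳ-≤ h z≤t[Δ∸3] ⟩
  h + t * (Δ ∸ 3)        ≤⟨ +-monoʳ-≤ h (*-monoʳ-≤ t (m∸n≤1+m∸[1+n] Δ 3)) ⟩
  h + t * suc (Δ ∸ 4)    ≡⟨ cong (h +_) (*-suc t (Δ ∸ 4)) ⟩
  h + (t + t * (Δ ∸ 4))  ≡⟨ +-assoc h t _ ⟨
  h + t + t * (Δ ∸ 4)    ≤⟨ +-mono-≤ h+t≤δ (*-monoˡ-≤ (Δ ∸ 4) t≤δ/2) ⟩
  δ + δ / 2 * (Δ ∸ 4)    ≡⟨ +-comm δ _ ⟩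
  δ / 2 * (Δ ∸ 4) + δ    ∎)
  where
  open ≤-Reasoning
  t≤δ/2 : t ≤ δ / 2
  t≤δ/2 = subst (_≤ δ / 2) (m*n/n≡m t 2) (/-monoˡ-≤ 2 (subst (_≤ δ) (*-comm 2 t) 2t≤δ))

-- w v i stands for |N(v) ∩ Vᵢ|, and partner i for a class forming a total
-- 2-coalition with Vᵢ.
module PartneredWeights
  {V : Set} {k : ℕ}
  (w : V → Fin k → ℕ)
  (partner : Fin k → Fin k)
  (partner-≢ : ∀ i → partner i ≢ i)
  (covered : ∀ v i → 2 ≤ w v i + w v (partner i))
  (deficient : ∀ i → ∃[ y ] w y i ≤ 1)
  {Δ : ℕ} (∑w≤Δ : ∀ v → ∑ (w v) ≤ Δ)
  (x : V) {δ : ℕ} (∑wₓ≤δ : ∑ (w x) ≤ δ)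
  where

  wₓ : Fin k → ℕ
  wₓ = w x

  hit missed heavy : ℕ
  hit    = ∑ (𝟙[≥1] ∘ wₓ)
  missed = ∑ (𝟙[≡0] ∘ wₓ)
  heavy  = ∑ (𝟙[≥2] ∘ wₓ)

  k≡hit+missed : k ≡ hit + missed
  k≡hit+missed = begin
    k                                        ≡⟨ ∑-const-1 k ⟨
    ∑ {k} (λ _ → 1)                          ≡⟨ sum-cong-≗ (𝟙[≥1]+𝟙[≡0]≡1 ∘ wₓ) ⟨
    ∑ (λ i → 𝟙[≥1] (wₓ i) + 𝟙[≡0] (wₓ i))   ≡⟨ ∑-distrib-+ (𝟙[≥1] ∘ wₓ) (𝟙[≡0] ∘ wₓ) ⟩
    hit + missed                             ∎
    where open ≡-Reasoning

  hit+heavy≤δ : hit + heavy ≤ δ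
  hit+heavy≤δ = begin
    hit + heavy                              ≡⟨ ∑-distrib-+ (𝟙[≥1] ∘ wₓ) (𝟙[≥2] ∘ wₓ) ⟨
    ∑ (λ i → 𝟙[≥1] (wₓ i) + 𝟙[≥2] (wₓ i))   ≤⟨ ∑-mono-≤ (𝟙[≥1]+𝟙[≥2]≤n ∘ wₓ) ⟩
    ∑ wₓ                                     ≤⟨ ∑wₓ≤δ ⟩
    δ                                        ∎
    where open ≤-Reasoning

  2*heavy≤δ : 2 * heavy ≤ δ
  2*heavy≤δ = begin
    2 * heavy                    ≡⟨ *-distribˡ-sum 2 (𝟙[≥2] ∘ wₓ) ⟩
    ∑ (λ i → 2 * 𝟙[≥2] (wₓ i))  ≤⟨ ∑-mono-≤ (2*𝟙[≥2]≤n ∘ wₓ) ⟩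
    ∑ wₓ                         ≤⟨ ∑wₓ≤δ ⟩
    δ                            ∎
    where open ≤-Reasoning

  -- missedWith j A is 1 if x has no neighbour in class A and A is partnered
  -- with j, and 0 otherwise.
  missedWith : Fin k → Fin k → ℕ
  missedWith j A = pointMass (partner A) (𝟙[≡0] (wₓ A)) j

  #missedWith : Fin k → ℕ
  #missedWith j = ∑ (missedWith j)

  missed≡∑#missedWith : missed ≡ ∑ #missedWith
  missed≡∑#missedWith = ≡.sym (∑-fibres partner (𝟙[≡0] ∘ wₓ))

  missedWith-pos : ∀ {j A} → 1 ≤ missedWith j A → wₓ A ≡ 0 × partner A ≡ j
  missedWith-pos 1≤ = let pA≡j , 1≤𝟙 = pointMass-pos 1≤ in 𝟙[≡0]-pos 1≤𝟙 , pA≡j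

  missedWith≤1 : ∀ j A → missedWith j A ≤ 1
  missedWith≤1 j A = pointMass≤ {f = λ _ → 1} (𝟙[≡0]≤1 (wₓ A)) j

  missedWith-hit : ∀ {j A} → 1 ≤ wₓ A → missedWith j A ≡ 0
  missedWith-hit {j} {A} 1≤wₓA = n≤0⇒n≡0 (pointMass≤ {f = λ _ → 0} (≤-reflexive (𝟙[≡0]-≥1 1≤wₓA)) j)

  missed≢heavy : ∀ {A B} → wₓ A ≡ 0 → 2 ≤ wₓ B → A ≢ B
  missed≢heavy wₓA≡0 2≤wₓA refl = contradiction (subst (2 ≤_) wₓA≡0 2≤wₓA) λ ()

  two-heavy⇒4≤Δ : ∀ {A B} → A ≢ B → 2 ≤ wₓ A → 2 ≤ wₓ B → 4 ≤ Δ
  two-heavy⇒4≤Δ A≢B 2≤wₓA 2≤wₓB = ≤-trans (+-mono-≤ 2≤wₓA 2≤wₓB) (≤-trans (∑-pair wₓ A≢B) (∑w≤Δ x))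

  two-heavy⇒2≤heavy : ∀ {A B} → A ≢ B → 2 ≤ wₓ A → 2 ≤ wₓ B → 2 ≤ heavy
  two-heavy⇒2≤heavy A≢B 2≤wₓA 2≤wₓB =
    subst (_≤ heavy) (cong₂ _+_ (𝟙[≥2]-≥2 2≤wₓA) (𝟙[≥2]-≥2 2≤wₓB)) (∑-pair (𝟙[≥2] ∘ wₓ) A≢B)

  missed⇒partner-heavy : ∀ A → wₓ A ≡ 0 → 2 ≤ wₓ (partner A)
  missed⇒partner-heavy A wₓA≡0 = subst (λ n → 2 ≤ n + wₓ (partner A)) wₓA≡0 (covered x A)

  #missedWith-heavy : ∀ {j} → 1 ≤ #missedWith j → 2 ≤ wₓ j
  #missedWith-heavy {j} 1≤ =
    let A , 1≤zA     = ∑-positive (missedWith j) 1≤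
        wₓA≡0 , pA≡j = missedWith-pos 1≤zA
    in subst (λ i → 2 ≤ wₓ i) pA≡j (missed⇒partner-heavy A wₓA≡0)

  missed≤heavy*[Δ∸3] : (∀ j → 1 ≤ #missedWith j → #missedWith j + 3 ≤ Δ) → missed ≤ heavy * (Δ ∸ 3)
  missed≤heavy*[Δ∸3] uncrowded = begin
    missed                             ≡⟨ missed≡∑#missedWith ⟩
    ∑ #missedWith                      ≤⟨ ∑-mono-≤ #missedWith≤ ⟩
    ∑ (λ j → 𝟙[≥2] (wₓ j) * (Δ ∸ 3))  ≡⟨ *-distribʳ-sum (Δ ∸ 3) (𝟙[≥2] ∘ wₓ) ⟨
    heavy * (Δ ∸ 3)                    ∎
    where
    open ≤-Reasoning
    #missedWith≤ : ∀ j → #missedWith j ≤ 𝟙[≥2] (wₓ j) * (Δ ∸ 3)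
    #missedWith≤ j with 1 ≤? #missedWith j
    ... | no  1≰ = ≤-trans (≤-reflexive (n<1⇒n≡0 (≰⇒> 1≰))) z≤n
    ... | yes 1≤ = begin
      #missedWith j                     ≤⟨ m+n≤o⇒m≤o∸n _ (uncrowded j 1≤) ⟩
      Δ ∸ 3                             ≡⟨ *-identityˡ (Δ ∸ 3) ⟨
      1 * (Δ ∸ 3)                       ≡⟨ cong (_* (Δ ∸ 3)) (𝟙[≥2]-≥2 (#missedWith-heavy 1≤)) ⟨
      𝟙[≥2] (wₓ j) * (Δ ∸ 3)            ∎

  -- j is the partner of at least Δ − 2 missed classes, which form the set Zⱼ
  -- with indicator z.  Charging one neighbour of the deficient vertex y to each
  -- class of Zⱼ leaves e, of total at most 2.
  module Crowded (j : Fin k) (1≤#j : 1 ≤ #missedWith j) (Δ<#j+3 : Δ < #missedWith j + 3) where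

    y : V
    y = proj₁ (deficient j)

    wy : Fin k → ℕ
    wy = w y

    wy[j]≤1 : wy j ≤ 1
    wy[j]≤1 = proj₂ (deficient j)

    heavy-j : 2 ≤ wₓ j
    heavy-j = #missedWith-heavy 1≤#j

    z e : Fin k → ℕ
    z   = missedWith j
    e U = wy U ∸ z U

    covered-with-j : ∀ {U} → partner U ≡ j → 2 ≤ wy U + wy j
    covered-with-j {U} pU≡j = subst (λ i → 2 ≤ wy U + wy i) pU≡j (covered y U)

    z≤wy : ∀ U → z U ≤ wy U
    z≤wy U with 1 ≤? z U
    ... | no  1≰zU = ≤-trans (≤-reflexive (n<1⇒n≡0 (≰⇒> 1≰zU))) z≤n
    ... | yes 1≤zU = ≤-trans (missedWith≤1 j U)
                       (2≤m+n⇒n≤1⇒1≤m (covered-with-j (proj₂ (missedWith-pos 1≤zU))) wy[j]≤1)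

    #j+∑e≤Δ : #missedWith j + ∑ e ≤ Δ
    #j+∑e≤Δ = begin
      #missedWith j + ∑ e   ≡⟨ ∑-distrib-+ z e ⟨
      ∑ (λ U → z U + e U)   ≡⟨ sum-cong-≗ (m+[n∸m]≡n ∘ z≤wy) ⟩
      ∑ wy                  ≤⟨ ∑w≤Δ y ⟩
      Δ                     ∎
      where open ≤-Reasoning

    ∑e≱3 : ¬ 3 ≤ ∑ e
    ∑e≱3 3≤∑e = <⇒≱ Δ<#j+3 (≤-trans (+-monoʳ-≤ (#missedWith j) 3≤∑e) #j+∑e≤Δ)

    e≡wy : ∀ {U} → z U ≡ 0 → e U ≡ wy U
    e≡wy {U} zU≡0 = cong (wy U ∸_) zU≡0

    wy≤1+e : ∀ U → wy U ≤ 1 + e U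
    wy≤1+e U = ≤-trans (m≤n+m∸n (wy U) (z U)) (+-monoˡ-≤ (e U) (missedWith≤1 j U))

    e≡wy-of-hit : ∀ {U} → 1 ≤ wₓ U → e U ≡ wy U
    e≡wy-of-hit = e≡wy ∘ missedWith-hit

    wy[j]≡0⇒1≤e : wy j ≡ 0 → ∀ {U} → partner U ≡ j → 1 ≤ e U
    wy[j]≡0⇒1≤e wy[j]≡0 {U} pU≡j = ≤-pred (begin
      2             ≤⟨ covered-with-j pU≡j ⟩
      wy U + wy j   ≡⟨ cong (wy U +_) wy[j]≡0 ⟩
      wy U + 0      ≡⟨ +-identityʳ (wy U) ⟩
      wy U          ≤⟨ wy≤1+e U ⟩
      1 + e U       ∎)
      where open ≤-Reasoning

    Outside : Fin k → Set
    Outside U = U ≢ j × z U ≡ 0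

    hit-outside : ∀ {U} → U ≢ j → 1 ≤ wₓ U → Outside U
    hit-outside U≢j 1≤wₓU = U≢j , missedWith-hit 1≤wₓU

    -- The unit sits at j if wy j = 1, and otherwise in any class of Zⱼ, where wy ≥ 2.
    extraUnit : ∃[ c ] (c ≡ j ⊎ 1 ≤ z c) × 1 ≤ e c
    extraUnit with 1 ≤? wy j
    ... | yes 1≤wy[j] = j , inj₁ refl , subst (1 ≤_) (≡.sym (e≡wy-of-hit (<⇒≤ heavy-j))) 1≤wy[j]
    ... | no  1≰wy[j] =
      let A , 1≤zA = ∑-positive z 1≤#j
      in  A , inj₂ 1≤zA , wy[j]≡0⇒1≤e (n<1⇒n≡0 (≰⇒> 1≰wy[j])) (proj₂ (missedWith-pos 1≤zA))

    c : Fin k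
    c = proj₁ extraUnit

    1≤e[c] : 1 ≤ e c
    1≤e[c] = proj₂ (proj₂ extraUnit)

    1≤z[c] : c ≢ j → 1 ≤ z c
    1≤z[c] c≢j with proj₁ (proj₂ extraUnit)
    ... | inj₁ c≡j  = contradiction c≡j c≢j
    ... | inj₂ 1≤zc = 1≤zc

    outside-≢c : ∀ {U} → Outside U → U ≢ c
    outside-≢c (U≢j , zU≡0) refl = contradiction (subst (1 ≤_) zU≡0 (1≤z[c] U≢j)) λ ()

    no-outside-pair : ∀ {A B} → A ≢ B → Outside A → Outside B → ¬ 2 ≤ wy A + wy B
    no-outside-pair {A} {B} A≢B outA outB 2≤ = ∑e≱3 (begin
      3                  ≤⟨ +-mono-≤ 2≤ 1≤e[c] ⟩
      wy A + wy B + e c  ≡⟨ cong₂ (λ a b → a + b + e c) (e≡wy (proj₂ outA)) (e≡wy (proj₂ outB)) ⟨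
      e A + e B + e c    ≤⟨ ∑-triple e A≢B (outside-≢c outA) (outside-≢c outB) ⟩
      ∑ e                ∎)
      where open ≤-Reasoning

    missed⇒partner≡j : ∀ A → wₓ A ≡ 0 → partner A ≡ j
    missed⇒partner≡j A wₓA≡0 with partner A ≟ j
    ... | yes pA≡j = pA≡j
    ... | no  pA≢j = contradiction (covered y A)
      (no-outside-pair (partner-≢ A ∘ ≡.sym)
        (missed≢heavy wₓA≡0 heavy-j , pointMass-≢ _ pA≢j)
        (hit-outside pA≢j (<⇒≤ (missed⇒partner-heavy A wₓA≡0))))

    missed≡#j : missed ≡ #missedWith j
    missed≡#j = sum-cong-≗ 𝟙[≡0]≡z
      where
      𝟙[≡0]≡z : ∀ A → 𝟙[≡0] (wₓ A) ≡ z A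
      𝟙[≡0]≡z A with 1 ≤? wₓ A
      ... | yes 1≤wₓA = trans (𝟙[≡0]-≥1 1≤wₓA) (≡.sym (missedWith-hit 1≤wₓA))
      ... | no  1≰wₓA = ≡.sym (trans
        (cong (λ i → pointMass i (𝟙[≡0] (wₓ A)) j) (missed⇒partner≡j A (n<1⇒n≡0 (≰⇒> 1≰wₓA))))
        (pointMass-diag j _))

    #j≤∑e : wy j ≡ 0 → #missedWith j ≤ ∑ e
    #j≤∑e wy[j]≡0 = ∑-mono-≤ z≤e
      where
      z≤e : ∀ A → z A ≤ e A
      z≤e A with 1 ≤? z A
      ... | no  1≰zA = ≤-trans (≤-reflexive (n<1⇒n≡0 (≰⇒> 1≰zA))) z≤n
      ... | yes 1≤zA = ≤-trans (missedWith≤1 j A) (wy[j]≡0⇒1≤e wy[j]≡0 (proj₂ (missedWith-pos 1≤zA)))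

    2≤∑e : 1 ≤ wy j → ∀ {U} → U ≢ j → 2 ≤ wₓ U → 2 ≤ ∑ e
    2≤∑e 1≤wy[j] {U} U≢j 2≤wₓU with partner U ≟ j
    ... | yes pU≡j = begin
      2              ≤⟨ covered-with-j pU≡j ⟩
      wy U + wy j    ≡⟨ cong₂ _+_ (e≡wy-of-hit (<⇒≤ 2≤wₓU)) (e≡wy-of-hit (<⇒≤ heavy-j)) ⟨
      e U + e j      ≤⟨ ∑-pair e U≢j ⟩
      ∑ e            ∎
      where open ≤-Reasoning
    ... | no  pU≢j = begin
      2                            ≤⟨ +-mono-≤ 1≤e[j] 1≤e[U]+e[pU] ⟩
      e j + (e U + e (partner U))  ≡⟨ +-assoc (e j) _ _ ⟨
      e j + e U + e (partner U)    ≤⟨ ∑-triple e (U≢j ∘ ≡.sym) (pU≢j ∘ ≡.sym) (partner-≢ U ∘ ≡.sym) ⟩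
      ∑ e                          ∎
      where
      open ≤-Reasoning
      1≤e[j] : 1 ≤ e j
      1≤e[j] = subst (1 ≤_) (≡.sym (e≡wy-of-hit (<⇒≤ heavy-j))) 1≤wy[j]
      1≤e[U]+e[pU] : 1 ≤ e U + e (partner U)
      1≤e[U]+e[pU] = ≤-pred (begin
        2                            ≤⟨ covered y U ⟩
        wy U + wy (partner U)        ≡⟨ cong (_+ wy (partner U)) (e≡wy-of-hit (<⇒≤ 2≤wₓU)) ⟨
        e U + wy (partner U)         ≤⟨ +-monoʳ-≤ (e U) (wy≤1+e (partner U)) ⟩
        e U + (1 + e (partner U))    ≡⟨ +-suc (e U) (e (partner U)) ⟩
        1 + (e U + e (partner U))    ∎)

    #j≤Δ∸2 : ∀ {U} → U ≢ j → 2 ≤ wₓ U → #missedWith j ≤ Δ ∸ 2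
    #j≤Δ∸2 U≢j 2≤wₓU with 1 ≤? wy j
    ... | yes 1≤wy[j] =
      m+n≤o⇒m≤o∸n _ (≤-trans (+-monoʳ-≤ (#missedWith j) (2≤∑e 1≤wy[j] U≢j 2≤wₓU)) #j+∑e≤Δ)
    ... | no  1≰wy[j] = begin
      #missedWith j  ≤⟨ #j≤∑e (n<1⇒n≡0 (≰⇒> 1≰wy[j])) ⟩
      ∑ e            ≤⟨ ≤-pred (≰⇒> ∑e≱3) ⟩
      2              ≤⟨ m+n≤o⇒m≤o∸n 2 (two-heavy⇒4≤Δ U≢j 2≤wₓU heavy-j) ⟩
      Δ ∸ 2          ∎
      where open ≤-Reasoning

    module SoleHeavy (light : ∀ U → U ≢ j → wₓ U ≤ 1) where

      hit⇒partner≡j : ∀ {U} → U ≢ j → 1 ≤ wₓ U → partner U ≡ j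
      hit⇒partner≡j {U} U≢j 1≤wₓU with partner U ≟ j
      ... | yes pU≡j = pU≡j
      ... | no  pU≢j = contradiction (covered y U)
        (no-outside-pair (partner-≢ U ∘ ≡.sym) (hit-outside U≢j 1≤wₓU) (hit-outside pU≢j 1≤wₓ[pU]))
        where
        1≤wₓ[pU] : 1 ≤ wₓ (partner U)
        1≤wₓ[pU] = 2≤m+n⇒n≤1⇒1≤m (subst (2 ≤_) (+-comm (wₓ U) _) (covered x U)) (light U U≢j)

      hit⇒1≤e : ∀ {U} → U ≢ j → 1 ≤ wₓ U → 1 ≤ e U
      hit⇒1≤e U≢j 1≤wₓU = subst (1 ≤_) (≡.sym (e≡wy-of-hit 1≤wₓU))
        (2≤m+n⇒n≤1⇒1≤m (covered-with-j (hit⇒partner≡j U≢j 1≤wₓU)) wy[j]≤1)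

      shifted-≢j : ∀ {U} → U ≢ j → 𝟙[≥1] (wₓ U) + pointMass c 1 U ≤ e U
      shifted-≢j {U} U≢j with c ≟ U
      ... | yes refl = begin
        𝟙[≥1] (wₓ c) + 1  ≡⟨ cong (λ n → 𝟙[≥1] n + 1) (proj₁ (missedWith-pos (1≤z[c] U≢j))) ⟩
        1                 ≤⟨ 1≤e[c] ⟩
        e c               ∎
        where open ≤-Reasoning
      ... | no  _    = begin
        𝟙[≥1] (wₓ U) + 0  ≡⟨ +-identityʳ _ ⟩
        𝟙[≥1] (wₓ U)      ≤⟨ 𝟙[≥1]≤ (hit⇒1≤e U≢j) ⟩
        e U               ∎
        where open ≤-Reasoning

      -- The unit of 𝟙[≥1] ∘ wₓ at j is moved to c, where e has one to spare.
      shifted : ∀ U → 𝟙[≥1] (wₓ U) + pointMass c 1 U ≤ e U + pointMass j 1 U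
      shifted U with U ≟ j
      ... | yes refl = begin
        𝟙[≥1] (wₓ j) + pointMass c 1 j  ≡⟨ cong (_+ pointMass c 1 j) (𝟙[≥1]-≥1 (<⇒≤ heavy-j)) ⟩
        1 + pointMass c 1 j             ≤⟨ +-monoʳ-≤ 1 (pointMass≤ {f = e} 1≤e[c] j) ⟩
        1 + e j                         ≡⟨ +-comm 1 (e j) ⟩
        e j + 1                         ≡⟨ cong (e j +_) (pointMass-diag j 1) ⟨
        e j + pointMass j 1 j           ∎
        where open ≤-Reasoning
      ... | no  U≢j  = begin
        𝟙[≥1] (wₓ U) + pointMass c 1 U  ≤⟨ shifted-≢j U≢j ⟩
        e U                             ≡⟨ +-identityʳ (e U) ⟨
        e U + 0                         ≡⟨ cong (e U +_) (pointMass-≢ 1 (U≢j ∘ ≡.sym)) ⟨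
        e U + pointMass j 1 U           ∎
        where open ≤-Reasoning

      hit≤∑e : hit ≤ ∑ e
      hit≤∑e = +-cancelʳ-≤ 1 hit (∑ e) (begin
        hit + 1                                     ≡⟨ cong (hit +_) (∑-pointMass c 1) ⟨
        hit + ∑ (pointMass c 1)                     ≡⟨ ∑-distrib-+ (𝟙[≥1] ∘ wₓ) (pointMass c 1) ⟨
        ∑ (λ U → 𝟙[≥1] (wₓ U) + pointMass c 1 U)  ≤⟨ ∑-mono-≤ shifted ⟩
        ∑ (λ U → e U + pointMass j 1 U)            ≡⟨ ∑-distrib-+ e (pointMass j 1) ⟩
        ∑ e + ∑ (pointMass j 1)                     ≡⟨ cong (∑ e +_) (∑-pointMass j 1) ⟩
        ∑ e + 1                                     ∎)
        where open ≤-Reasoning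

      hit+missed≤Δ : hit + missed ≤ Δ
      hit+missed≤Δ = begin
        hit + missed         ≡⟨ cong (hit +_) missed≡#j ⟩
        hit + #missedWith j  ≤⟨ +-monoˡ-≤ _ hit≤∑e ⟩
        ∑ e + #missedWith j  ≡⟨ +-comm (∑ e) _ ⟩
        #missedWith j + ∑ e  ≤⟨ #j+∑e≤Δ ⟩
        Δ                    ∎
        where open ≤-Reasoning

    dichotomy : missed ≤ heavy * (Δ ∸ 3) ⊎ hit + missed ≤ Δ
    dichotomy with any? (λ U → ¬? (U ≟ j) ×-dec (2 ≤? wₓ U))
    ... | yes (U , U≢j , 2≤wₓU) = inj₁ (begin
      missed           ≡⟨ missed≡#j ⟩
      #missedWith j    ≤⟨ #j≤Δ∸2 U≢j 2≤wₓU ⟩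
      Δ ∸ 2            ≤⟨ Δ∸2≤2*[Δ∸3] (two-heavy⇒4≤Δ U≢j 2≤wₓU heavy-j) ⟩
      2 * (Δ ∸ 3)      ≤⟨ *-monoˡ-≤ (Δ ∸ 3) (two-heavy⇒2≤heavy U≢j 2≤wₓU heavy-j) ⟩
      heavy * (Δ ∸ 3)  ∎)
      where open ≤-Reasoning
    ... | no ∄U =
      inj₂ (SoleHeavy.hit+missed≤Δ λ U U≢j → ≤-pred (≰⇒> λ 2≤wₓU → ∄U (U , U≢j , 2≤wₓU)))

  dichotomy : missed ≤ heavy * (Δ ∸ 3) ⊎ hit + missed ≤ Δ
  dichotomy with any? (λ j → (1 ≤? #missedWith j) ×-dec (Δ <? #missedWith j + 3))
  ... | yes (j , 1≤#j , Δ<#j+3) = Crowded.dichotomy j 1≤#j Δ<#j+3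
  ... | no  ∄j = inj₁ (missed≤heavy*[Δ∸3] λ j 1≤#j → ≮⇒≥ λ Δ<#j+3 → ∄j (j , 1≤#j , Δ<#j+3))

  k≤bound : k ≤ Δ ⊔ (δ / 2 * (Δ ∸ 4) + δ)
  k≤bound = subst (_≤ Δ ⊔ (δ / 2 * (Δ ∸ 4) + δ)) (≡.sym k≡hit+missed) (by-cases dichotomy)
    where
    by-cases : missed ≤ heavy * (Δ ∸ 3) ⊎ hit + missed ≤ Δ → hit + missed ≤ Δ ⊔ (δ / 2 * (Δ ∸ 4) + δ)
    by-cases (inj₁ missed≤) = count≤bound {Δ = Δ} hit+heavy≤δ 2*heavy≤δ missed≤
    by-cases (inj₂ ≤Δ)      = m≤n⇒m≤n⊔o _ ≤Δ

-- Total 2-coalition partitions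

𝟙 : Bool → ℕ
𝟙 b = if b then 1 else 0

𝟙-∧-≟ : ∀ {n} b (a c : Fin n) → 𝟙 (b ∧ ⌊ a ≟ c ⌋) ≡ pointMass a (𝟙 b) c
𝟙-∧-≟ b a c with a ≟ c
𝟙-∧-≟ true  a c | yes _ = refl
𝟙-∧-≟ false a c | yes _ = refl
𝟙-∧-≟ true  a c | no  _ = refl
𝟙-∧-≟ false a c | no  _ = refl

𝟙-∧-∨ : ∀ {n} b (a : Fin n) {i j} → i ≢ j →
        𝟙 (b ∧ (⌊ a ≟ i ⌋ ∨ ⌊ a ≟ j ⌋)) ≡ 𝟙 (b ∧ ⌊ a ≟ i ⌋) + 𝟙 (b ∧ ⌊ a ≟ j ⌋)
𝟙-∧-∨ false a i≢j = refl
𝟙-∧-∨ true  a {i} {j} i≢j with a ≟ i | a ≟ j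
... | yes a≡i | yes a≡j = contradiction (trans (≡.sym a≡i) a≡j) i≢j
... | yes _   | no  _   = refl
... | no  _   | yes _   = refl
... | no  _   | no  _   = refl

≤-foldr-⊔ : ∀ {n} {ns : List ℕ} → n ∈ ns → n ≤ foldr _⊔_ 0 ns
≤-foldr-⊔ (here refl) = m≤m⊔n _ _
≤-foldr-⊔ (there n∈) = m≤n⇒m≤o⊔n _ (≤-foldr-⊔ n∈)

foldr-⊓-attained : ∀ {A : Set} (f : A → ℕ) a (as : List A) → ∃[ b ] f b ≤ foldr _⊓_ (f a) (map f as)
foldr-⊓-attained f a []       = a , ≤-refl
foldr-⊓-attained f a (b ∷ as) with ⊓-sel (f b) (foldr _⊓_ (f a) (map f as))
... | inj₁ min≡f[b] = b , ≤-reflexive (≡.sym min≡f[b])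
... | inj₂ min≡rest = let b′ , f[b′]≤rest = foldr-⊓-attained f a as
                      in b′ , ≤-trans f[b′]≤rest (≤-reflexive (≡.sym min≡rest))

module _ (G : Graph) where

  deg≤maxDeg : ∀ v → deg G v ≤ maxDeg G
  deg≤maxDeg v = ≤-foldr-⊔ (∈-map⁺ (deg G) (∈-allFin v))

  minDeg-attained : ∃[ v ] deg G v ≤ minDeg G
  minDeg-attained = foldr-⊓-attained (deg G) zero (allFin _)

  nbrsIn-∑ : ∀ v S → nbrsIn G v S ≡ ∑ (λ u → 𝟙 (adj G v u ∧ S u))
  nbrsIn-∑ v S = ∑-tabulate (λ u → 𝟙 (adj G v u ∧ S u))

  module _ {k : ℕ} (P : Partition G k) where

    classWeight : V G → Fin k → ℕ
    classWeight v i = nbrsIn G v (classOf P i)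

    ∑-classWeight : ∀ v → ∑ (classWeight v) ≡ deg G v
    ∑-classWeight v = begin
      ∑ (classWeight v)                                            ≡⟨ sum-cong-≗ classWeight-pointMass ⟩
      ∑ (λ i → ∑ (λ u → pointMass (cls P u) (𝟙 (adj G v u)) i))  ≡⟨ ∑-fibres (cls P) (𝟙 ∘ adj G v) ⟩
      ∑ (λ u → 𝟙 (adj G v u))                                      ≡⟨ sum-cong-≗ (cong 𝟙 ∘ ∧-identityʳ ∘ adj G v) ⟨
      ∑ (λ u → 𝟙 (adj G v u ∧ true))                               ≡⟨ nbrsIn-∑ v (λ _ → true) ⟨
      deg G v                                                      ∎
      where
      open ≡-Reasoning
      classWeight-pointMass : ∀ i → classWeight v i ≡ ∑ (λ u → pointMass (cls P u) (𝟙 (adj G v u)) i)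
      classWeight-pointMass i =
        trans (nbrsIn-∑ v (classOf P i)) (sum-cong-≗ λ u → 𝟙-∧-≟ (adj G v u) (cls P u) i)

    classWeight-∪ : ∀ v {i j} → i ≢ j → nbrsIn G v (unionOf P i j) ≡ classWeight v i + classWeight v j
    classWeight-∪ v {i} {j} i≢j = begin
      nbrsIn G v (unionOf P i j)                  ≡⟨ nbrsIn-∑ v (unionOf P i j) ⟩
      ∑ (λ u → 𝟙 (adj G v u ∧ unionOf P i j u))   ≡⟨ sum-cong-≗ (λ u → 𝟙-∧-∨ (adj G v u) (cls P u) i≢j) ⟩
      ∑ (λ u → adjIn i u + adjIn j u)             ≡⟨ ∑-distrib-+ (adjIn i) (adjIn j) ⟩
      ∑ (adjIn i) + ∑ (adjIn j)                   ≡⟨ cong₂ _+_ (nbrsIn-∑ v (classOf P i)) (nbrsIn-∑ v (classOf P j)) ⟨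
      classWeight v i + classWeight v j           ∎
      where
      open ≡-Reasoning
      adjIn : Fin k → V G → ℕ
      adjIn l u = 𝟙 (adj G v u ∧ classOf P l u)

    deficient-vertex : ∀ {i} → ¬ IsTotal2Dom G (classOf P i) → ∃[ y ] classWeight y i ≤ 1
    deficient-vertex {i} ¬dom =
      let y , 2≰ = ¬∀⟶∃¬ _ (λ v → 2 ≤ classWeight v i) (λ v → 2 ≤? classWeight v i) ¬dom
      in  y , ≤-pred (≰⇒> 2≰)

tc2Partition≤bound : (G : Graph) {k : ℕ} (P : Partition G k) → IsTC2Partition P → k ≤ bound G
tc2Partition≤bound G {k} P isTC2 =
  PartneredWeights.k≤bound w partner partner-≢ covered deficient
    (λ v → ≤-trans (≤-reflexive (∑-classWeight G P v)) (deg≤maxDeg G v))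
    x (≤-trans (≤-reflexive (∑-classWeight G P x)) deg[x]≤δ)
  where
  w : V G → Fin k → ℕ
  w = classWeight G P
  partner : Fin k → Fin k
  partner i = proj₁ (isTC2 i)
  partner-≢ : ∀ i → partner i ≢ i
  partner-≢ i = proj₁ (proj₂ (isTC2 i))
  covered : ∀ v i → 2 ≤ w v i + w v (partner i)
  covered v i =
    let _ , _ , _ , _ , i∪partner-total2Dom = isTC2 i
    in  subst (2 ≤_) (classWeight-∪ G P v (partner-≢ i ∘ ≡.sym)) (i∪partner-total2Dom v)
  deficient : ∀ i → ∃[ y ] w y i ≤ 1
  deficient i = let _ , _ , ¬total2Dom , _ = isTC2 i in deficient-vertex G P ¬total2Dom
  x : V G
  x = proj₁ (minDeg-attained G)
  deg[x]≤δ : deg G x ≤ minDeg G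
  deg[x]≤δ = proj₂ (minDeg-attained G)

-- Sharpness

≟-sym : ∀ {n} (u v : Fin n) → ⌊ u ≟ v ⌋ ≡ ⌊ v ≟ u ⌋
≟-sym u v with u ≟ v | v ≟ u
... | yes _   | yes _   = refl
... | no  _   | no  _   = refl
... | yes u≡v | no  v≢u = contradiction (≡.sym u≡v) v≢u
... | no  u≢v | yes v≡u = contradiction (≡.sym v≡u) u≢v

complete : ℕ → Graph
complete n = record
  { m     = n
  ; adj   = λ u v → not ⌊ u ≟ v ⌋
  ; sym   = λ u v → cong not (≟-sym u v)
  ; irrfl = λ v → cong (not ∘ ⌊_⌋) (≡-≟-identity _≟_ refl)
  }

complete-connected : ∀ n → Connected (complete n)
complete-connected n u v with u ≟ v
... | yes refl = here
... | no  u≢v  = step here (cong (not ∘ ⌊_⌋) (≢-≟-identity _≟_ u≢v))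

K₃ : Graph
K₃ = complete 2

-- bound K₃ = 2, attained by the partition {0}, {1, 2}.
K₃-split : Partition K₃ 2
K₃-split = record
  { cls  = λ { zero → zero ; (suc _) → suc zero }
  ; onto = λ { zero → zero , refl ; (suc zero) → suc zero , refl }
  }

class₀-¬total2Dom : ¬ IsTotal2Dom K₃ (classOf K₃-split zero)
class₀-¬total2Dom dom = contradiction (dom zero) λ ()

class₁-¬total2Dom : ¬ IsTotal2Dom K₃ (classOf K₃-split (suc zero))
class₁-¬total2Dom dom = contradiction (dom (suc zero)) λ { (s≤s ()) }

K₃-split-isTC2 : IsTC2Partition K₃-split
K₃-split-isTC2 zero       = suc zero , (λ ()) , class₀-¬total2Dom , class₁-¬total2Dom ,
  λ { zero → ≤-refl ; (suc zero) → ≤-refl ; (suc (suc zero)) → ≤-refl }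
K₃-split-isTC2 (suc zero) = zero , (λ ()) , class₁-¬total2Dom , class₀-¬total2Dom ,
  λ { zero → ≤-refl ; (suc zero) → ≤-refl ; (suc (suc zero)) → ≤-refl }

theorem3p5 :
    (∀ (G : Graph) → Connected G → 2 ≤ minDeg G →
       ∀ (k : ℕ) (P : Partition G k) → IsTC2Partition P → k ≤ bound G)
    × (∃[ G ] (Connected G × 2 ≤ minDeg G × HasTC2 G (bound G)))
theorem3p5 =
  (λ G _ _ _ → tc2Partition≤bound G) ,
  (K₃ , complete-connected 2 , ≤-refl , (K₃-split , K₃-split-isTC2) , λ _ → tc2Partition≤bound K₃)
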